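{- Let $Q$ and $n$ be positive integers such that $n$ is even and $S_{Qn}(Qn)\equiv n\pmod{Qn}$. Then $Q$ is even.
   Context: For positive integers $m,k$, $S_m(k):=1^m+2^m+\cdots+k^m$. -}

module Defs where

open import Data.Nat using (ℕ; zero; suc; _+_; _^_)

S : ℕ → ℕ → ℕ
S m zero = 0
S m (suc k) = S m k + suc k ^ m

open import Data.Nat.Divisibility using (_∣_)

Even : ℕ → Set
Even n = 2 ∣ n

-- Write N = Q n and let 2^(b+1) be the exact power of 2 dividing n. Every odd x
-- satisfies x^(2^b) ≡ 1 mod 2^(b+1), and 2^b ∣ N, so x^N ≡ 1; every even x has
-- x^N ≡ 0 mod 2^(b+1). Hence S_N(N) ≡ N/2 mod 2^(b+1), while the hypothesis gives
-- S_N(N) ≡ n ≡ 0. So 2^(b+1) divides N/2 = 2^b Q (n/2^(b+1)), and since n/2^(b+1)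
-- is odd, 2 ∣ Q.
module Submission where

open import Defs
open import Data.Nat using (ℕ; _*_; _<_)
open import Data.Integer using (+_; _-_)
open import Data.Integer.Divisibility using (_∣_)
open import Data.Integer.Base using (-_) renaming (_+_ to _ℤ+_)

open import Data.Nat.Base using (zero; suc; _+_; _^_; _≤_; z≤n; s≤s; z<s; s<s; NonZero; >-nonZero)
open import Data.Nat.Properties
open import Data.Nat.Divisibility as ℕ
  using (divides; ∣-trans; 1∣_; n∣m*n; m∣m*n; *-pres-∣; ∣⇒≤; ∣m+n∣m⇒∣n; ∣1⇒≡1)
open import Data.Nat.Induction using (<-rec)
open import Data.Nat.Primality using (Prime; prime?; euclidsLemma)
import Data.Integer.Properties as ℤ
import Data.Integer.Divisibility.Signed as ℤ
open import Data.Product using (∃; ∃₂; _,_)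
open import Data.Sum using (_⊎_; inj₁; inj₂; [_,_])
open import Data.Empty using (⊥-elim)
open import Function using (id; _∘_)
open import Relation.Nullary using (¬_)
open import Relation.Nullary.Decidable using (from-yes)
open import Relation.Binary.PropositionalEquality using (_≡_; refl; sym; trans; cong; cong₂; subst; subst₂; module ≡-Reasoning)
open import Data.Nat.Tactic.RingSolver using (solve-∀)

2-prime : Prime 2
2-prime = from-yes (prime? 2)

even⊎odd : ∀ n → (∃ λ k → n ≡ k * 2) ⊎ (∃ λ k → n ≡ suc (k * 2))
even⊎odd zero = inj₁ (0 , refl)
even⊎odd (suc n) with even⊎odd n
... | inj₁ (k , refl) = inj₂ (k , refl)
... | inj₂ (k , refl) = inj₁ (suc k , refl)

odd⇒¬even : ∀ m → ¬ 2 ℕ.∣ suc (m * 2)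
odd⇒¬even m 2∣odd with ∣1⇒≡1 (∣m+n∣m⇒∣n (subst (2 ℕ.∣_) (+-comm 1 (m * 2)) 2∣odd) (n∣m*n m))
... | ()

n≡2^a*odd : ∀ n → 0 < n → ∃₂ λ a m → n ≡ 2 ^ a * suc (m * 2)
n≡2^a*odd = <-rec _ decompose
  where
  decompose : ∀ n → (∀ {k} → k < n → 0 < k → ∃₂ λ a m → k ≡ 2 ^ a * suc (m * 2)) →
              0 < n → ∃₂ λ a m → n ≡ 2 ^ a * suc (m * 2)
  decompose n rec 0<n with even⊎odd n
  ... | inj₂ (m , refl) = 0 , m , sym (+-identityʳ _)
  ... | inj₁ (suc k , refl) with rec (s≤s (s≤s (m≤m*n k 2))) z<s
  ...   | a , m , eq = suc a , m , trans (cong (_* 2) eq) (double-assoc (2 ^ a) (suc (m * 2)))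
    where
    double-assoc : ∀ p q → p * q * 2 ≡ 2 * p * q
    double-assoc = solve-∀

n<2^n : ∀ n → n < 2 ^ n
n<2^n zero = z<s
n<2^n (suc n) = begin-strict
  suc n         <⟨ s<s (n<2^n n) ⟩
  1 + 2 ^ n     ≤⟨ +-monoˡ-≤ (2 ^ n) (m^n>0 2 n) ⟩
  2 ^ n + 2 ^ n ≡⟨ cong (λ x → 2 ^ n + x) (+-identityʳ (2 ^ n)) ⟨
  2 ^ suc n     ∎
  where open ≤-Reasoning

[1+d*t]^e≡1+d*t′ : ∀ d t e → ∃ λ t′ → (1 + d * t) ^ e ≡ 1 + d * t′
[1+d*t]^e≡1+d*t′ d t zero = 0 , cong suc (sym (*-zeroʳ d))
[1+d*t]^e≡1+d*t′ d t (suc e) with [1+d*t]^e≡1+d*t′ d t e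
... | t′ , eq = t + t′ + d * t * t′ , trans (cong ((1 + d * t) *_) eq) (product d t t′)
  where
  product : ∀ d t t′ → (1 + d * t) * (1 + d * t′) ≡ 1 + d * (t + t′ + d * t * t′)
  product = solve-∀

odd^2^k≡1+2^[1+k]*t : ∀ k x → ∃ λ t → suc (x * 2) ^ (2 ^ k) ≡ 1 + 2 ^ suc k * t
odd^2^k≡1+2^[1+k]*t zero x = x , odd^1 x
  where
  odd^1 : ∀ x → suc (x * 2) * 1 ≡ 1 + 2 * 1 * x
  odd^1 = solve-∀
odd^2^k≡1+2^[1+k]*t (suc k) x with odd^2^k≡1+2^[1+k]*t k x
... | t , eq = t + 2 ^ k * t * t , (begin
  B ^ (2 * 2 ^ k)               ≡⟨ cong (B ^_) (*-comm 2 (2 ^ k)) ⟩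
  B ^ (2 ^ k * 2)               ≡⟨ ^-*-assoc B (2 ^ k) 2 ⟨
  (B ^ 2 ^ k) ^ 2               ≡⟨ cong (_^ 2) eq ⟩
  (1 + 2 * 2 ^ k * t) ^ 2       ≡⟨ square (2 ^ k) t ⟩
  1 + 2 * (2 * 2 ^ k) * (t + 2 ^ k * t * t) ∎)
  where
  open ≡-Reasoning
  B = suc (x * 2)
  square : ∀ p t → (1 + 2 * p * t) * ((1 + 2 * p * t) * 1) ≡ 1 + 2 * (2 * p) * (t + p * t * t)
  square = solve-∀

2^k∣N⇒odd^N≡1+2^[1+k]*t : ∀ {k N} → 2 ^ k ℕ.∣ N → ∀ x → ∃ λ t → suc (x * 2) ^ N ≡ 1 + 2 ^ suc k * t
2^k∣N⇒odd^N≡1+2^[1+k]*t {k} (divides e refl) x with odd^2^k≡1+2^[1+k]*t k x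
... | t , eq with [1+d*t]^e≡1+d*t′ (2 ^ suc k) t e
... | t′ , eq′ = t′ , (begin
  B ^ (e * 2 ^ k)        ≡⟨ cong (B ^_) (*-comm e (2 ^ k)) ⟩
  B ^ (2 ^ k * e)        ≡⟨ ^-*-assoc B (2 ^ k) e ⟨
  (B ^ 2 ^ k) ^ e        ≡⟨ cong (_^ e) eq ⟩
  (1 + 2 ^ suc k * t) ^ e ≡⟨ eq′ ⟩
  1 + 2 ^ suc k * t′     ∎)
  where
  open ≡-Reasoning
  B = suc (x * 2)

k≤N⇒2^k∣even^N : ∀ {k N} → k ≤ N → ∀ y → 2 ^ k ℕ.∣ (y * 2) ^ N
k≤N⇒2^k∣even^N z≤n       y = 1∣ _
k≤N⇒2^k∣even^N (s≤s k≤N) y = *-pres-∣ (n∣m*n y) (k≤N⇒2^k∣even^N k≤N y)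

S[N,2j]≡j : ∀ {N d} → (∀ x → ∃ λ t → suc (x * 2) ^ N ≡ 1 + d * t) → (∀ y → d ℕ.∣ (y * 2) ^ N) →
            ∀ j → ∃ λ t → S N (j * 2) ≡ j + d * t
S[N,2j]≡j {d = d} odd^N even^N zero = 0 , sym (*-zeroʳ d)
S[N,2j]≡j {N} {d} odd^N even^N (suc j)
  with S[N,2j]≡j odd^N even^N j | odd^N j | even^N (suc j)
... | t , e₀ | t₁ , e₁ | divides t₂ e₂ = t + t₁ + t₂ , (begin
  S N (j * 2) + suc (j * 2) ^ N + (suc j * 2) ^ N ≡⟨ cong₂ _+_ (cong₂ _+_ e₀ e₁) e₂ ⟩
  j + d * t + (1 + d * t₁) + t₂ * d               ≡⟨ regroup j d t t₁ t₂ ⟩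
  suc j + d * (t + t₁ + t₂)                       ∎)
  where
  open ≡-Reasoning
  regroup : ∀ j d t t₁ t₂ → j + d * t + (1 + d * t₁) + t₂ * d ≡ suc j + d * (t + t₁ + t₂)
  regroup = solve-∀

S[N,2j]≡j[mod2^[1+b]] : ∀ {b N} .{{_ : NonZero N}} → 2 ^ suc b ℕ.∣ N →
                        ∀ j → ∃ λ t → S N (j * 2) ≡ j + 2 ^ suc b * t
S[N,2j]≡j[mod2^[1+b]] {b} {N} 2^[1+b]∣N =
  S[N,2j]≡j (2^k∣N⇒odd^N≡1+2^[1+k]*t {k = b} (∣-trans (n∣m*n 2) 2^[1+b]∣N))
            (k≤N⇒2^k∣even^N (≤-trans (<⇒≤ (n<2^n (suc b))) (∣⇒≤ 2^[1+b]∣N)))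

∣[a+d*t]-b∧∣b⇒∣a : ∀ {a b d t} → + d ∣ + (a + d * t) - + b → d ℕ.∣ b → d ℕ.∣ a
∣[a+d*t]-b∧∣b⇒∣a {a} {b} {d} {t} d∣a+dt-b d∣b = ℤ.∣⇒∣ᵤ (ℤ.∣m+n∣n⇒∣m {m = + a} d∣a+[dt-b] d∣dt-b)
  where
  d∣a+[dt-b] : + d ℤ.∣ + a ℤ+ (+ (d * t) - + b)
  d∣a+[dt-b] = subst (+ d ℤ.∣_)
    (trans (cong (_- + b) (ℤ.pos-+ a (d * t))) (ℤ.+-assoc (+ a) (+ (d * t)) (- + b)))
    (ℤ.∣ᵤ⇒∣ d∣a+dt-b)
  d∣dt-b : + d ℤ.∣ + (d * t) - + b
  d∣dt-b = ℤ.∣m∣n⇒∣m-n (ℤ.∣ᵤ⇒∣ {i = + (d * t)} (m∣m*n t)) (ℤ.∣ᵤ⇒∣ {i = + b} d∣b)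

lemma4 : (Q n : ℕ) → 0 < Q → 0 < n → Even n →
    (+ (Q * n)) ∣ (+ S (Q * n) (Q * n) - + n) →
    Even Q
lemma4 Q n 0<Q 0<n (divides k refl) hyp with n≡2^a*odd k (*-cancelʳ-< 2 0 k 0<n)
... | b , m , refl = [ id , ⊥-elim ∘ odd⇒¬even m ] (euclidsLemma Q M 2-prime 2∣Q*M)
  where
  M = suc (m * 2)
  J = Q * (2 ^ b * M)
  d∣n : 2 ^ suc b ℕ.∣ n
  d∣n = divides M (shuffle (2 ^ b) M)
    where
    shuffle : ∀ p M → p * M * 2 ≡ M * (2 * p)
    shuffle = solve-∀
  d∣N : 2 ^ suc b ℕ.∣ Q * n
  d∣N = ℕ.∣n⇒∣m*n Q d∣n
  2∣Q*M : 2 ℕ.∣ Q * M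
  2∣Q*M with S[N,2j]≡j[mod2^[1+b]] {b = b} {{>-nonZero (*-mono-< 0<Q 0<n)}} d∣N J
  ... | t , S[N,2J]≡J+dt = ℕ.*-cancelˡ-∣ (2 ^ b) {{m^n≢0 2 b}} 2^b*2∣2^b*[Q*M]
    where
    S[N,N]≡J+dt : S (Q * n) (Q * n) ≡ J + 2 ^ suc b * t
    S[N,N]≡J+dt = trans (cong (S _) (sym (*-assoc Q (2 ^ b * M) 2))) S[N,2J]≡J+dt
    d∣J : 2 ^ suc b ℕ.∣ J
    d∣J = ∣[a+d*t]-b∧∣b⇒∣a (subst (λ s → + (2 ^ suc b) ∣ + s - + n) S[N,N]≡J+dt (∣-trans d∣N hyp)) d∣n
    2^b*2∣2^b*[Q*M] : 2 ^ b * 2 ℕ.∣ 2 ^ b * (Q * M)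
    2^b*2∣2^b*[Q*M] = subst₂ ℕ._∣_ (*-comm 2 (2 ^ b)) (swap Q (2 ^ b) M) d∣J
      where
      swap : ∀ q p M → q * (p * M) ≡ p * (q * M)
      swap = solve-∀
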